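{- For every $n\ge -1$: (i) $|\breve{\mathrm{Cil}}\Gamma_+[n]|_k = n+2$ if $k=n$, $=n+1$ if $k=n+1$, and $=0$ if $k\notin\{n,n+1\}$; (ii) $|\mathrm{Cil}\,\partial\Gamma_+[n]| = \sum_{i=-1}^{n-1}\binom{n+1}{i+1}\,|\breve{\mathrm{Cil}}\Gamma_+[i]|$; (iii) $|\mathrm{Cil}\Gamma_+[n]| = |\mathrm{Cil}\,\partial\Gamma_+[n]| + |\breve{\mathrm{Cil}}\Gamma_+[n]|$.
   Context: $[n]=\{0<\dots<n\}$ for $n\ge0$, $[-1]=\emptyset$; $\Gamma_+[n]_p$ is the set of strictly increasing maps $[p]\to[n]$ ($p\ge-1$; $\Gamma_+[n]_{ -1}=\{\emptyset\}$). For $\sigma\in\Gamma_+[n]_p$, $\tau\in\Gamma_+[n]_q$ write $\sigma\preccurlyeq\tau$ if $|\sigma([p])\cap\tau([q])|\le 1$ and $\sigma(i)\le\tau(j)$ for all $i\in[p]$, $j\in[q]$. The standard cylinder $\mathrm{Cil}\Gamma_+[n]$ is the augmented semi-simplicial set with $\mathrm{Cil}\Gamma_+[n]_m=\{(\sigma,\tau)\in\Gamma_+[n]_p\times\Gamma_+[n]_q: p,q\ge-1,\ p+q=m-1,\ \sigma\preccurlyeq\tau\}$ for $m\ge -1$, with faces $d_i(\sigma,\tau)=(d_i\sigma,\tau)$ for $0\le i\le p$ and $(\sigma,d_{i-p-1}\tau)$ for $p+1\le i\le m$. $\mathrm{Cil}\,\partial\Gamma_+[n]$ is the sub-object of pairs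 with $\sigma([p])\cup\tau([q])\subsetneq[n]$ (the cylinder of the boundary of $\Gamma_+[n]$), and $\breve{\mathrm{Cil}}\Gamma_+[n]=\mathrm{Cil}\Gamma_+[n]\setminus\mathrm{Cil}\,\partial\Gamma_+[n]$ is the set of pairs with $\sigma([p])\cup\tau([q])=[n]$. For a graded collection $Y$ of finite sets, $|Y|$ is the sequence $(|Y_m|)_{m\ge-1}$, and sums of sequences are termwise. -}

module Defs where

open import Data.Nat using (ℕ; zero; suc; _+_)
open import Data.Fin using (Fin; _<_; _≤_)
open import Data.Vec using (Vec; lookup)
open import Data.Vec.Membership.Propositional using (_∈_)
open import Data.Sum using (_⊎_)
open import Data.Product using (_×_)
open import Relation.Binary.PropositionalEquality using (_≡_)
open import Relation.Nullary using (¬_)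

-- Index shift convention: the paper's [n] (n ≥ -1) is encoded by N = n + 1,
-- i.e. [n] = Fin N; dimensions m ≥ -1 are encoded by K = m + 1.

-- Γ₊[n]_p with N = n+1, P = p+1 : strictly increasing maps [p] → [n],
-- represented by their table of values (a vector of length P).
record Inc (N P : ℕ) : Set where
  constructor mkInc
  field
    vals : Vec (Fin N) P
    .increasing : ∀ (i j : Fin P) → i < j → lookup vals i < lookup vals j
open Inc public

_∈Im_ : ∀ {N P} → Fin N → Inc N P → Set
a ∈Im σ = a ∈ vals σ

_≼_ : ∀ {N P Q} → Inc N P → Inc N Q → Set
_≼_ {N} {P} {Q} σ τ =
  (∀ (a b : Fin N) → a ∈Im σ → a ∈Im τ → b ∈Im σ → b ∈Im τ → a ≡ b)
  × ((i : Fin P) (j : Fin Q) → lookup (vals σ) i ≤ lookup (vals τ) j)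

-- Cil Γ₊[n]_m with N = n+1, K = m+1 : pairs (σ, τ) ∈ Γ₊[n]_p × Γ₊[n]_q,
-- P = p+1, Q = q+1, p + q = m - 1 (i.e. P + Q = K), σ ≼ τ.
record Cil (N K : ℕ) : Set where
  constructor mkCil
  field
    P Q : ℕ
    .sumPQ : P + Q ≡ K
    σ : Inc N P
    τ : Inc N Q
    .prec : σ ≼ τ
open Cil public

Covers : ∀ {N K} → Cil N K → Set
Covers {N} c = ∀ (a : Fin N) → a ∈Im σ c ⊎ a ∈Im τ c

record Sub (A : Set) (Pr : A → Set) : Set where
  constructor _,_
  field
    elem : A
    .holds : Pr elem

CilBoundary : ℕ → ℕ → Set
CilBoundary N K = Sub (Cil N K) (λ c → ¬ Covers c)

BreveCil : ℕ → ℕ → Set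
BreveCil N K = Sub (Cil N K) Covers

-- Read a pair σ ≼ τ point by point: each point of [n] is missed, or lies in σ only, in both, or
-- in τ only, and since σ lies below τ and they share at most one point, the points hit read
-- left…left, optionally followed by `both` or `right`, and then right…right. Forgetting the missed
-- points, a face [i] ⊆ [n], leaves a covering pair of [i]; so Cil Γ₊[n] is the disjoint union,
-- over the faces [i] of [n], of copies of Cil˘Γ₊[i], and the boundary is the part over proper
-- faces. Counting words gives (i): n+2 words without `both` in dimension n and n+1 with `both` in
-- dimension n+1. Part (ii) follows as [n] has C(n+1, i+1) faces [i], and (iii) as covering is
-- decidable.

module Submission where

open import Defs
open import Data.Nat using (ℕ; zero; suc; _+_; _*_; z≤n; s≤s; z<s; s≤s⁻¹; s<s⁻¹)
  renaming (_<_ to _<ℕ_; _≤_ to _≤ℕ_)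
open import Data.Nat.Properties
  using ( suc-injective; ≡-irrelevant; <-irrelevant; _≟_; _<?_; 1+n≢n; 1+n≰n; n≮0; ≤∧≢⇒<; <⇒≢
        ; ≤-trans; n≤1+n; ≤-<-trans; <-trans; <-≤-trans)
open import Data.Nat.Combinatorics using (_C_; nCk+nC[k+1]≡[n+1]C[k+1])
open import Data.List using (map; upTo; applyUpTo)
open import Data.List.Properties using (map-upTo)
open import Data.Nat.ListAction using (sum)
open import Data.Fin using (Fin; zero; suc; toℕ; _<_; _≤_) renaming (_≟_ to _≟ᶠ_)
open import Data.Fin.Properties using (+↔⊎; *↔×; all?)
import Data.Fin.Properties as Finₚ
open import Data.Vec using (Vec; []; _∷_; lookup) renaming (map to mapᵛ)
open import Data.Vec.Properties using (lookup-map)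
open import Data.Vec.Relation.Unary.Any using (here; there)
open import Data.Vec.Membership.Propositional using (_∈_; _∉_)
open import Data.Vec.Membership.Propositional.Properties using (∈-map⁺)
import Data.Vec.Membership.DecPropositional as DecMembership
open import Data.Product using (Σ; Σ-syntax; _×_; _,_; proj₁; proj₂) renaming (map to map×)
open import Data.Product.Function.NonDependent.Propositional using (_×-↔_)
open import Data.Sum using (_⊎_; inj₁; inj₂; [_,_]) renaming (map to map⊎)
open import Data.Sum.Function.Propositional using (_⊎-↔_)
open import Data.Empty using (⊥-elim; ⊥-elim-irr)
open import Function using (_∘_)
open import Function.Bundles using (_↔_; mk↔ₛ′; Inverse; _⇔_; mk⇔; Equivalence)
open import Function.Properties.Inverse using (↔-trans; ↔-sym; ↔-refl)
open import Function.Related.TypeIsomorphisms using (¬-cong-⇔)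
open import Function.Properties.Equivalence using () renaming (trans to ⇔-trans; sym to ⇔-sym)
open import Relation.Binary.PropositionalEquality
  using (_≡_; _≢_; refl; sym; trans; cong; cong₂; subst; subst₂)
open import Relation.Nullary using (¬_; Dec; yes; no)
open import Relation.Nullary.Decidable using (recompute; _⊎-dec_)

private
  variable
    A B : Set
    N I R S K R′ S′ : ℕ

Fin-cong : ∀ {m n} → m ≡ n → Fin m ↔ Fin n
Fin-cong refl = ↔-refl

¬→↔Fin0 : ¬ A → A ↔ Fin 0
¬→↔Fin0 ¬a = mk↔ₛ′ (⊥-elim ∘ ¬a) (λ ()) (λ ()) (⊥-elim ∘ ¬a)

≡↔Fin1 : {m n : ℕ} → m ≡ n → (m ≡ n) ↔ Fin 1
≡↔Fin1 m≡n = mk↔ₛ′ (λ _ → zero) (λ _ → m≡n) (λ { zero → refl }) (≡-irrelevant m≡n)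

⊎₃↔Fin+ : ∀ {a b c} → (Fin a ⊎ Fin b ⊎ Fin c) ↔ Fin (a + (b + c))
⊎₃↔Fin+ = ↔-sym (↔-trans +↔⊎ (↔-refl ⊎-↔ +↔⊎))

Sub-≡ : {P : A → Set} {x y : A} .{p : P x} .{q : P y} → x ≡ y → _≡_ {A = Sub A P} (x , p) (y , q)
Sub-≡ refl = refl

Sub-↔ : {P : A → Set} {Q : B → Set} (e : A ↔ B) →
  (∀ b → P (Inverse.from e b) ⇔ Q b) → Sub A P ↔ Sub B Q
Sub-↔ {P = P} e P⇔Q = mk↔ₛ′
  (λ (a , p) → to a , Equivalence.to (P⇔Q (to a)) (subst P (sym (strictlyInverseʳ a)) p))
  (λ (b , q) → from b , Equivalence.from (P⇔Q b) q)
  (λ (b , _) → Sub-≡ (strictlyInverseˡ b))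
  (λ (a , _) → Sub-≡ (strictlyInverseʳ a))
  where open Inverse e

↔-Sub-¬⊎Sub : {P : A → Set} → (∀ a → Dec (P a)) → A ↔ (Sub A (¬_ ∘ P) ⊎ Sub A P)
↔-Sub-¬⊎Sub {A = A} {P} P? = mk↔ₛ′ (λ a → split a (P? a)) forget split∘forget (λ a → forget∘split a (P? a))
  where
  split : (a : A) → Dec (P a) → Sub A (¬_ ∘ P) ⊎ Sub A P
  split a (yes p) = inj₂ (a , p)
  split a (no ¬p) = inj₁ (a , ¬p)
  forget : Sub A (¬_ ∘ P) ⊎ Sub A P → A
  forget (inj₁ (a , _)) = a
  forget (inj₂ (a , _)) = a
  forget∘split : (a : A) (d : Dec (P a)) → forget (split a d) ≡ a
  forget∘split a (yes _) = refl
  forget∘split a (no _) = refl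
  split∘forget : ∀ x → split (forget x) (P? (forget x)) ≡ x
  split∘forget (inj₁ (a , ¬p)) with P? a
  ... | yes p = ⊥-elim-irr (¬p p)
  ... | no _ = refl
  split∘forget (inj₂ (a , p)) with P? a
  ... | yes _ = refl
  ... | no ¬p = ⊥-elim-irr (¬p p)

Sub-Σ-≡↔ : {B : ℕ → Set} → Sub (Σ ℕ B) (λ x → proj₁ x ≡ N) ↔ B N
Sub-Σ-≡↔ {N} {B} = mk↔ₛ′
  (λ ((I , b) , I≡N) → subst B (recompute (I ≟ N) I≡N) b)
  (λ b → (N , b) , refl)
  (λ b → cong (λ e → subst B e b) (≡-irrelevant _ refl))
  (λ ((I , b) , I≡N) → Sub-≡ (subst-Σ (recompute (I ≟ N) I≡N) b))
  where
  subst-Σ : ∀ {I} (e : I ≡ N) (b : B I) → _≡_ {A = Σ ℕ B} (N , subst B e b) (I , b)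
  subst-Σ refl b = refl

Σ< : ℕ → (ℕ → Set) → Set
Σ< N B = Σ[ I ∈ ℕ ] I <ℕ N × B I

Sub-Σ-≢↔ : {B : ℕ → Set} → (∀ {I} → B I → I ≤ℕ N) → Sub (Σ ℕ B) (λ x → proj₁ x ≢ N) ↔ Σ< N B
Sub-Σ-≢↔ {N} bound = mk↔ₛ′
  (λ ((I , b) , I≢N) → I , recompute (I <? N) (≤∧≢⇒< (bound b) I≢N) , b)
  (λ (I , I<N , b) → (I , b) , <⇒≢ I<N)
  (λ (I , I<N , b) → cong (λ l → I , l , b) (<-irrelevant _ _))
  (λ _ → refl)

Σ<-suc↔ : {B : ℕ → Set} → Σ< (suc N) B ↔ (B 0 ⊎ Σ< N (B ∘ suc))
Σ<-suc↔ {N} {B} = mk↔ₛ′ to from to∘from from∘to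
  where
  to : Σ< (suc N) B → B 0 ⊎ Σ< N (B ∘ suc)
  to (zero , _ , b) = inj₁ b
  to (suc I , s≤s I<N , b) = inj₂ (I , I<N , b)
  from : B 0 ⊎ Σ< N (B ∘ suc) → Σ< (suc N) B
  from (inj₁ b) = zero , z<s , b
  from (inj₂ (I , I<N , b)) = suc I , s≤s I<N , b
  to∘from : ∀ y → to (from y) ≡ y
  to∘from (inj₁ _) = refl
  to∘from (inj₂ _) = refl
  from∘to : ∀ x → from (to x) ≡ x
  from∘to (zero , z<s , _) = refl
  from∘to (suc I , s≤s _ , _) = refl

Σ<↔Fin-sum : {B : ℕ → Set} (f : ℕ → ℕ) → (∀ I → B I ↔ Fin (f I)) → Σ< N B ↔ Fin (sum (map f (upTo N)))
Σ<↔Fin-sum {N} f B↔f = ↔-trans (Σ<↔Fin-sum-applyUpTo f B↔f) (Fin-cong (cong sum (sym (map-upTo f N))))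
  where
  Σ<↔Fin-sum-applyUpTo : ∀ {N} {B : ℕ → Set} (f : ℕ → ℕ) → (∀ I → B I ↔ Fin (f I)) →
    Σ< N B ↔ Fin (sum (applyUpTo f N))
  Σ<↔Fin-sum-applyUpTo {zero} f B↔f = ¬→↔Fin0 λ ()
  Σ<↔Fin-sum-applyUpTo {suc N} f B↔f =
    ↔-trans Σ<-suc↔ (↔-trans (B↔f 0 ⊎-↔ Σ<↔Fin-sum-applyUpTo (f ∘ suc) (B↔f ∘ suc)) (↔-sym +↔⊎))

data Mask : ℕ → ℕ → Set where
  done : Mask 0 0
  skip : Mask N I → Mask (suc N) I
  keep : Mask N I → Mask (suc N) (suc I)

Mask-bound : Mask N I → I ≤ℕ N
Mask-bound done = z≤n
Mask-bound (skip m) = ≤-trans (Mask-bound m) (n≤1+n _)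
Mask-bound (keep m) = s≤s (Mask-bound m)

full : ∀ N → Mask N N
full zero = done
full (suc N) = keep (full N)

full-unique : (m : Mask N N) → m ≡ full N
full-unique done = refl
full-unique (skip m) = ⊥-elim (1+n≰n (Mask-bound m))
full-unique (keep m) = cong keep (full-unique m)

Mask-full×↔ : (Mask N N × A) ↔ A
Mask-full×↔ {N} = mk↔ₛ′ proj₂ (full N ,_) (λ _ → refl) (λ (m , a) → cong (_, a) (sym (full-unique m)))

Mask↔Fin-C : ∀ N I → Mask N I ↔ Fin (N C I)
Mask↔Fin-C zero zero = mk↔ₛ′ (λ _ → zero) (λ _ → done) (λ { zero → refl }) (λ { done → refl })
Mask↔Fin-C zero (suc I) = ¬→↔Fin0 λ ()
Mask↔Fin-C (suc N) zero = ↔-trans skip↔ (Mask↔Fin-C N zero)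
  where
  skip↔ : Mask (suc N) 0 ↔ Mask N 0
  skip↔ = mk↔ₛ′ (λ { (skip m) → m }) skip (λ _ → refl) (λ { (skip _) → refl })
Mask↔Fin-C (suc N) (suc I) =
  ↔-trans keep⊎skip↔ (↔-trans (Mask↔Fin-C N I ⊎-↔ Mask↔Fin-C N (suc I))
    (↔-trans (↔-sym +↔⊎) (Fin-cong (nCk+nC[k+1]≡[n+1]C[k+1] N I))))
  where
  keep⊎skip↔ : Mask (suc N) (suc I) ↔ (Mask N I ⊎ Mask N (suc I))
  keep⊎skip↔ = mk↔ₛ′ (λ { (keep m) → inj₁ m ; (skip m) → inj₂ m }) [ keep , skip ]
    (λ { (inj₁ _) → refl ; (inj₂ _) → refl }) (λ { (keep _) → refl ; (skip _) → refl })

sucs : Vec (Fin N) R → Vec (Fin (suc N)) R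
sucs = mapᵛ suc

Inc-≡ : {σ τ : Inc N R} → vals σ ≡ vals τ → σ ≡ τ
Inc-≡ {σ = mkInc v _} {mkInc .v _} refl = refl

Positive : Vec (Fin (suc N)) R → Set
Positive v = ∀ i → 0 <ℕ toℕ (lookup v i)

sucs-positive : (v : Vec (Fin N) R) → Positive (sucs v)
sucs-positive v i = subst (λ x → 0 <ℕ toℕ x) (sym (lookup-map i suc v)) z<s

Increasing : Vec (Fin N) R → Set
Increasing v = ∀ i j → i < j → lookup v i < lookup v j

sucs-increasing : {v : Vec (Fin N) R} → Increasing v → Increasing (sucs v)
sucs-increasing {v = v} inc i j i<j =
  subst₂ _<_ (sym (lookup-map i suc v)) (sym (lookup-map j suc v)) (s≤s (inc i j i<j))

[]ᴵ : Inc N 0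
[]ᴵ = mkInc [] λ ()

shift : Inc N R → Inc (suc N) R
shift (mkInc v inc) = mkInc (sucs v) (sucs-increasing {v = v} inc)

cons0 : Inc N R → Inc (suc N) (suc R)
cons0 (mkInc v inc) = mkInc (zero ∷ sucs v) λ where
  zero (suc j) _ → sucs-positive v j
  (suc i) (suc j) (s≤s i<j) → sucs-increasing {v = v} inc i j i<j

tail : Inc N (suc R) → Inc N R
tail (mkInc (_ ∷ v) inc) = mkInc v λ i j i<j → inc (suc i) (suc j) (s≤s i<j)

pred⁺ : (x : Fin (suc N)) → .(0 <ℕ toℕ x) → Fin N
pred⁺ (suc x) _ = x

suc-pred⁺ : (x : Fin (suc N)) .(x>0 : 0 <ℕ toℕ x) → suc (pred⁺ x x>0) ≡ x
suc-pred⁺ (suc x) _ = refl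

unshiftᵛ : (v : Vec (Fin (suc N)) R) → .(Positive v) → Vec (Fin N) R
unshiftᵛ [] _ = []
unshiftᵛ (x ∷ v) pos = pred⁺ x (pos zero) ∷ unshiftᵛ v (pos ∘ suc)

sucs-unshiftᵛ : (v : Vec (Fin (suc N)) R) .(pos : Positive v) → sucs (unshiftᵛ v pos) ≡ v
sucs-unshiftᵛ [] _ = refl
sucs-unshiftᵛ (x ∷ v) pos = cong₂ _∷_ (suc-pred⁺ x (pos zero)) (sucs-unshiftᵛ v (pos ∘ suc))

unshiftᵛ-sucs : (v : Vec (Fin N) R) .(pos : Positive (sucs v)) → unshiftᵛ (sucs v) pos ≡ v
unshiftᵛ-sucs [] _ = refl
unshiftᵛ-sucs (x ∷ v) pos = cong (x ∷_) (unshiftᵛ-sucs v (pos ∘ suc))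

unshift : (σ : Inc (suc N) R) → .(Positive (vals σ)) → Inc N R
unshift (mkInc v inc) pos = mkInc u λ i j i<j → s<s⁻¹ (subst₂ _<_ (lookup-u i) (lookup-u j) (inc i j i<j))
  where
  u = unshiftᵛ v pos
  lookup-u : ∀ i → lookup v i ≡ suc (lookup u i)
  lookup-u i = trans (cong (λ w → lookup w i) (sym (sucs-unshiftᵛ v pos))) (lookup-map i suc u)

shift-unshift : (σ : Inc (suc N) R) .(pos : Positive (vals σ)) → shift (unshift σ pos) ≡ σ
shift-unshift σ pos = Inc-≡ (sucs-unshiftᵛ (vals σ) pos)

unshift-shift : (σ : Inc N R) → unshift (shift σ) (sucs-positive (vals σ)) ≡ σ
unshift-shift σ = Inc-≡ (unshiftᵛ-sucs (vals σ) (sucs-positive (vals σ)))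

cons0-unshift-tail : (σ : Inc (suc N) (suc R)) .(pos : Positive (vals (tail σ))) →
  lookup (vals σ) zero ≡ zero → cons0 (unshift (tail σ) pos) ≡ σ
cons0-unshift-tail (mkInc (x ∷ v) _) pos x≡0 = Inc-≡ (cong₂ _∷_ (sym x≡0) (sucs-unshiftᵛ v pos))

tail-positive : {x : Fin (suc N)} {v : Vec (Fin (suc N)) R} → Increasing (x ∷ v) → Positive v
tail-positive inc i = ≤-<-trans z≤n (inc zero (suc i) z<s)

head-positive : {y : Fin N} {v : Vec (Fin (suc N)) R} → Increasing (suc y ∷ v) → Positive (suc y ∷ v)
head-positive inc zero = z<s
head-positive inc (suc i) = <-trans z<s (inc zero (suc i) z<s)

≼-positive : (σ : Inc (suc N) (suc R)) (τ : Inc (suc N) S) →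
  0 <ℕ toℕ (lookup (vals σ) zero) → σ ≼ τ → Positive (vals τ)
≼-positive _ _ x>0 (_ , below) j = <-≤-trans x>0 (below zero j)

zero∉sucs : {v : Vec (Fin N) R} → zero ∉ sucs v
zero∉sucs {v = _ ∷ _} (there h) = zero∉sucs h

∈-sucs⁻ : {a : Fin N} {v : Vec (Fin N) R} → suc a ∈ sucs v → a ∈ v
∈-sucs⁻ {v = _ ∷ _} (here refl) = here refl
∈-sucs⁻ {v = _ ∷ _} (there h) = there (∈-sucs⁻ h)

[]≼ : (σ : Inc N 0) (τ : Inc N S) → σ ≼ τ
[]≼ (mkInc [] _) τ = (λ _ _ ()) , (λ ())

tail-≼ : (σ : Inc N (suc R)) (τ : Inc N S) → σ ≼ τ → tail σ ≼ τ
tail-≼ (mkInc (_ ∷ _) _) _ (share , below) =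
  (λ a b a∈σ a∈τ b∈σ b∈τ → share a b (there a∈σ) a∈τ (there b∈σ) b∈τ) , (λ i → below (suc i))

shift-≼ : (σ : Inc N R) (τ : Inc N S) → σ ≼ τ → shift σ ≼ shift τ
shift-≼ σ@(mkInc u _) τ@(mkInc v _) (share , below) = share′ , below′
  where
  share′ : ∀ a b → a ∈Im shift σ → a ∈Im shift τ → b ∈Im shift σ → b ∈Im shift τ → a ≡ b
  share′ zero _ a∈σ _ _ _ = ⊥-elim (zero∉sucs a∈σ)
  share′ (suc _) zero _ _ b∈σ _ = ⊥-elim (zero∉sucs b∈σ)
  share′ (suc a) (suc b) a∈σ a∈τ b∈σ b∈τ =
    cong suc (share a b (∈-sucs⁻ a∈σ) (∈-sucs⁻ a∈τ) (∈-sucs⁻ b∈σ) (∈-sucs⁻ b∈τ))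
  below′ : ∀ i j → lookup (sucs u) i ≤ lookup (sucs v) j
  below′ i j = subst₂ _≤_ (sym (lookup-map i suc u)) (sym (lookup-map j suc v)) (s≤s (below i j))

shift-≼⁻ : (σ : Inc N R) (τ : Inc N S) → shift σ ≼ shift τ → σ ≼ τ
shift-≼⁻ (mkInc u _) (mkInc v _) (share , below) =
  (λ a b a∈σ a∈τ b∈σ b∈τ →
    Finₚ.suc-injective
      (share (suc a) (suc b) (∈-map⁺ suc a∈σ) (∈-map⁺ suc a∈τ) (∈-map⁺ suc b∈σ) (∈-map⁺ suc b∈τ))) ,
  (λ i j → s≤s⁻¹ (subst₂ _≤_ (lookup-map i suc u) (lookup-map j suc v) (below i j)))

unshift-≼ : (σ : Inc (suc N) R) (τ : Inc (suc N) S) .(p : Positive (vals σ)) .(q : Positive (vals τ)) →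
  σ ≼ τ → unshift σ p ≼ unshift τ q
unshift-≼ σ τ p q σ≼τ =
  shift-≼⁻ (unshift σ p) (unshift τ q) (subst₂ _≼_ (sym (shift-unshift σ p)) (sym (shift-unshift τ q)) σ≼τ)

cons0≼shift : (σ : Inc N R) (τ : Inc N S) → σ ≼ τ → cons0 σ ≼ shift τ
cons0≼shift σ@(mkInc _ _) τ@(mkInc _ _) σ≼τ = share′ , below′
  where
  share′ : ∀ a b → a ∈Im cons0 σ → a ∈Im shift τ → b ∈Im cons0 σ → b ∈Im shift τ → a ≡ b
  share′ _ _ (here refl) a∈τ _ _ = ⊥-elim (zero∉sucs a∈τ)
  share′ _ _ (there _) _ (here refl) b∈τ = ⊥-elim (zero∉sucs b∈τ)
  share′ a b (there a∈σ) a∈τ (there b∈σ) b∈τ = proj₁ (shift-≼ σ τ σ≼τ) a b a∈σ a∈τ b∈σ b∈τ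
  below′ : ∀ i j → lookup (vals (cons0 σ)) i ≤ lookup (vals (shift τ)) j
  below′ zero _ = z≤n
  below′ (suc i) j = proj₂ (shift-≼ σ τ σ≼τ) i j

cons0≼cons0 : (σ : Inc N 0) (τ : Inc N S) → cons0 σ ≼ cons0 τ
cons0≼cons0 (mkInc [] _) _ = share′ , λ { zero _ → z≤n }
  where
  share′ : {v : Vec (Fin (suc N)) (suc S)} (a b : Fin (suc N)) →
    a ∈ zero ∷ [] → a ∈ v → b ∈ zero ∷ [] → b ∈ v → a ≡ b
  share′ _ _ (here refl) _ (here refl) _ = refl

zero∷zero-¬≼ : (σ : Inc (suc N) (suc (suc R))) (τ : Inc (suc N) (suc S)) →
  Increasing (vals σ) → lookup (vals τ) zero ≡ zero → ¬ σ ≼ τ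
zero∷zero-¬≼ σ τ inc τ₀≡0 (_ , below) =
  n≮0 (<-≤-trans σ₁>0 (subst (λ x → lookup (vals σ) (suc zero) ≤ x) τ₀≡0 (below (suc zero) zero)))
  where
  σ₁>0 : 0 <ℕ toℕ (lookup (vals σ) (suc zero))
  σ₁>0 = ≤-<-trans z≤n (inc zero (suc zero) z<s)

-- Covering pairs, read from the first point, which lies in σ only (left), in both (both) or in
-- τ only (right); after both or right, every further point lies in τ only.
data Shape : ℕ → ℕ → ℕ → Set where
  done  : Shape 0 0 0
  left  : Shape N R S → Shape (suc N) (suc R) S
  both  : Shape N 0 S → Shape (suc N) 1 (suc S)
  right : Shape N 0 S → Shape (suc N) 0 (suc S)

Factored : ℕ → ℕ → ℕ → Set
Factored N R S = Σ[ I ∈ ℕ ] Mask N I × Shape I R S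

decode : Mask N I → Shape I R S → Inc N R × Inc N S
decode done done = []ᴵ , []ᴵ
decode (skip m) sh = map× shift shift (decode m sh)
decode (keep m) (left sh) = map× cons0 shift (decode m sh)
decode (keep m) (both sh) = map× cons0 cons0 (decode m sh)
decode (keep m) (right sh) = map× shift cons0 (decode m sh)

decodeᶠ : Factored N R S → Inc N R × Inc N S
decodeᶠ (_ , m , sh) = decode m sh

decode-≼ : (m : Mask N I) (sh : Shape I R S) → proj₁ (decode m sh) ≼ proj₂ (decode m sh)
decode-≼ done done = []≼ []ᴵ []ᴵ
decode-≼ (skip m) sh = let σ , τ = decode m sh in shift-≼ σ τ (decode-≼ m sh)
decode-≼ (keep m) (left sh) = let σ , τ = decode m sh in cons0≼shift σ τ (decode-≼ m sh)
decode-≼ (keep m) (both sh) = let σ , τ = decode m sh in cons0≼cons0 σ τ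
decode-≼ (keep m) (right sh) = let σ , τ = decode m sh in []≼ (shift σ) (cons0 τ)

skipᶠ : Factored N R S → Factored (suc N) R S
skipᶠ (I , m , sh) = I , skip m , sh

leftᶠ : Factored N R S → Factored (suc N) (suc R) S
leftᶠ (I , m , sh) = suc I , keep m , left sh

bothᶠ : Factored N 0 S → Factored (suc N) 1 (suc S)
bothᶠ (I , m , sh) = suc I , keep m , both sh

rightᶠ : Factored N 0 S → Factored (suc N) 0 (suc S)
rightᶠ (I , m , sh) = suc I , keep m , right sh

encode : (σ : Inc N R) (τ : Inc N S) → .(σ ≼ τ) → Factored N R S
encode {zero} (mkInc [] _) (mkInc [] _) _ = 0 , done , done
encode {suc N} (mkInc [] _) (mkInc [] _) _ = skipᶠ (encode []ᴵ []ᴵ ([]≼ []ᴵ []ᴵ))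
encode {suc N} (mkInc [] _) τ@(mkInc (zero ∷ _) inc) _ = rightᶠ (encode []ᴵ τ′ ([]≼ []ᴵ τ′))
  where τ′ = unshift (tail τ) (tail-positive inc)
encode {suc N} (mkInc [] _) τ@(mkInc (suc _ ∷ _) inc) _ = skipᶠ (encode []ᴵ τ′ ([]≼ []ᴵ τ′))
  where τ′ = unshift τ (head-positive inc)
encode {suc N} σ@(mkInc (zero ∷ _) inc) τ@(mkInc [] _) σ≼τ =
  leftᶠ (encode σ′ τ′ (unshift-≼ (tail σ) τ (tail-positive inc) (λ ()) (tail-≼ σ τ σ≼τ)))
  where σ′ = unshift (tail σ) (tail-positive inc)
        τ′ = unshift τ λ ()
encode {suc N} σ@(mkInc (zero ∷ _) inc) τ@(mkInc (suc _ ∷ _) inc′) σ≼τ =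
  leftᶠ (encode σ′ τ′ (unshift-≼ (tail σ) τ (tail-positive inc) (head-positive inc′) (tail-≼ σ τ σ≼τ)))
  where σ′ = unshift (tail σ) (tail-positive inc)
        τ′ = unshift τ (head-positive inc′)
encode {suc N} (mkInc (zero ∷ []) _) τ@(mkInc (zero ∷ _) inc) _ = bothᶠ (encode []ᴵ τ′ ([]≼ []ᴵ τ′))
  where τ′ = unshift (tail τ) (tail-positive inc)
encode {suc N} σ@(mkInc (zero ∷ _ ∷ _) inc) τ@(mkInc (zero ∷ _) _) σ≼τ =
  ⊥-elim-irr (zero∷zero-¬≼ σ τ inc refl σ≼τ)
encode {suc N} σ@(mkInc (suc _ ∷ _) inc) τ σ≼τ =
  skipᶠ (encode σ′ τ′ (unshift-≼ σ τ (head-positive inc) (≼-positive σ τ z<s σ≼τ) σ≼τ))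
  where σ′ = unshift σ (head-positive inc)
        τ′ = unshift τ (≼-positive σ τ z<s σ≼τ)

encode-cong : {σ σ′ : Inc N R} {τ τ′ : Inc N S} → σ ≡ σ′ → τ ≡ τ′ →
  .{p : σ ≼ τ} .{p′ : σ′ ≼ τ′} → encode σ τ p ≡ encode σ′ τ′ p′
encode-cong refl refl = refl

encode-skip : (σ : Inc N R) (τ : Inc N S) .{p : shift σ ≼ shift τ} .{q : σ ≼ τ} →
  encode (shift σ) (shift τ) p ≡ skipᶠ (encode σ τ q)
encode-skip (mkInc [] _) (mkInc [] _) = refl
encode-skip (mkInc [] _) τ@(mkInc (_ ∷ _) _) = cong skipᶠ (encode-cong refl (unshift-shift τ))
encode-skip σ@(mkInc (_ ∷ _) _) τ = cong skipᶠ (encode-cong (unshift-shift σ) (unshift-shift τ))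

encode-left : (σ : Inc N R) (τ : Inc N S) .{p : cons0 σ ≼ shift τ} .{q : σ ≼ τ} →
  encode (cons0 σ) (shift τ) p ≡ leftᶠ (encode σ τ q)
encode-left σ (mkInc [] _) = cong leftᶠ (encode-cong (unshift-shift σ) refl)
encode-left σ τ@(mkInc (_ ∷ _) _) = cong leftᶠ (encode-cong (unshift-shift σ) (unshift-shift τ))

encode-both : (σ : Inc N 0) (τ : Inc N S) .{p : cons0 σ ≼ cons0 τ} .{q : σ ≼ τ} →
  encode (cons0 σ) (cons0 τ) p ≡ bothᶠ (encode σ τ q)
encode-both (mkInc [] _) τ = cong bothᶠ (encode-cong refl (unshift-shift τ))

encode-right : (σ : Inc N 0) (τ : Inc N S) .{p : shift σ ≼ cons0 τ} .{q : σ ≼ τ} →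
  encode (shift σ) (cons0 τ) p ≡ rightᶠ (encode σ τ q)
encode-right (mkInc [] _) τ = cong rightᶠ (encode-cong refl (unshift-shift τ))

encode-decode : (m : Mask N I) (sh : Shape I R S) →
  let σ , τ = decode m sh in encode σ τ (decode-≼ m sh) ≡ (I , m , sh)
encode-decode done done = refl
encode-decode (skip m) sh =
  let σ , τ = decode m sh in trans (encode-skip σ τ) (cong skipᶠ (encode-decode m sh))
encode-decode (keep m) (left sh) =
  let σ , τ = decode m sh in trans (encode-left σ τ) (cong leftᶠ (encode-decode m sh))
encode-decode (keep m) (both sh) =
  let σ , τ = decode m sh in trans (encode-both σ τ) (cong bothᶠ (encode-decode m sh))
encode-decode (keep m) (right sh) =
  let σ , τ = decode m sh in trans (encode-right σ τ) (cong rightᶠ (encode-decode m sh))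

decode-encode : (σ : Inc N R) (τ : Inc N S) .(σ≼τ : σ ≼ τ) → decodeᶠ (encode σ τ σ≼τ) ≡ (σ , τ)
decode-encode {zero} (mkInc [] _) (mkInc [] _) _ = refl
decode-encode {suc N} (mkInc [] _) (mkInc [] _) _ =
  cong (map× shift shift) (decode-encode []ᴵ []ᴵ _)
decode-encode {suc N} (mkInc [] _) τ@(mkInc (zero ∷ _) inc) _ =
  trans (cong (map× shift cons0) (decode-encode []ᴵ τ′ _)) (cong ([]ᴵ ,_) (cons0-unshift-tail τ (tail-positive inc) refl))
  where τ′ = unshift (tail τ) (tail-positive inc)
decode-encode {suc N} (mkInc [] _) τ@(mkInc (suc _ ∷ _) inc) _ =
  trans (cong (map× shift shift) (decode-encode []ᴵ τ′ _)) (cong ([]ᴵ ,_) (shift-unshift τ (head-positive inc)))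
  where τ′ = unshift τ (head-positive inc)
decode-encode {suc N} σ@(mkInc (zero ∷ _) inc) τ@(mkInc [] _) _ =
  trans (cong (map× cons0 shift) (decode-encode σ′ τ′ _))
        (cong (_, τ) (cons0-unshift-tail σ (tail-positive inc) refl))
  where σ′ = unshift (tail σ) (tail-positive inc)
        τ′ = unshift τ λ ()
decode-encode {suc N} σ@(mkInc (zero ∷ _) inc) τ@(mkInc (suc _ ∷ _) inc′) _ =
  trans (cong (map× cons0 shift) (decode-encode σ′ τ′ _))
        (cong₂ _,_ (cons0-unshift-tail σ (tail-positive inc) refl) (shift-unshift τ (head-positive inc′)))
  where σ′ = unshift (tail σ) (tail-positive inc)
        τ′ = unshift τ (head-positive inc′)
decode-encode {suc N} σ@(mkInc (zero ∷ []) _) τ@(mkInc (zero ∷ _) inc) _ =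
  trans (cong (map× cons0 cons0) (decode-encode []ᴵ τ′ _))
        (cong (σ ,_) (cons0-unshift-tail τ (tail-positive inc) refl))
  where τ′ = unshift (tail τ) (tail-positive inc)
decode-encode {suc N} σ@(mkInc (zero ∷ _ ∷ _) inc) τ@(mkInc (zero ∷ _) _) σ≼τ =
  ⊥-elim-irr (zero∷zero-¬≼ σ τ inc refl σ≼τ)
decode-encode {suc N} σ@(mkInc (suc _ ∷ _) inc) τ σ≼τ =
  trans (cong (map× shift shift) (decode-encode σ′ τ′ _))
        (cong₂ _,_ (shift-unshift σ (head-positive inc)) (shift-unshift τ (≼-positive σ τ z<s σ≼τ)))
  where σ′ = unshift σ (head-positive inc)
        τ′ = unshift τ (≼-positive σ τ z<s σ≼τ)

CoversPair : Inc N R × Inc N S → Set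
CoversPair {N} (σ , τ) = (a : Fin N) → a ∈Im σ ⊎ a ∈Im τ

record Lifts (σ : Inc N R) (σ′ : Inc (suc N) S) : Set where
  constructor lifts
  field suc∈⇔∈ : (a : Fin N) → (suc a ∈Im σ′) ⇔ (a ∈Im σ)
open Lifts

shift-lifts : (σ : Inc N R) → Lifts σ (shift σ)
shift-lifts σ = lifts λ _ → mk⇔ ∈-sucs⁻ (∈-map⁺ suc)

cons0-lifts : (σ : Inc N R) → Lifts σ (cons0 σ)
cons0-lifts σ = lifts λ _ → mk⇔ (λ { (here ()) ; (there h) → ∈-sucs⁻ h }) (there ∘ ∈-map⁺ suc)

lift-covers : {σ : Inc N R} {τ : Inc N S} {σ′ : Inc (suc N) R′} {τ′ : Inc (suc N) S′} →
  Lifts σ σ′ → Lifts τ τ′ → zero ∈Im σ′ ⊎ zero ∈Im τ′ → CoversPair (σ′ , τ′) ⇔ CoversPair (σ , τ)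
lift-covers σ↑ τ↑ zero∈ = mk⇔
  (λ cov′ a → map⊎ (Equivalence.to (suc∈⇔∈ σ↑ a)) (Equivalence.to (suc∈⇔∈ τ↑ a)) (cov′ (suc a)))
  (λ { cov zero → zero∈
      ; cov (suc a) → map⊎ (Equivalence.from (suc∈⇔∈ σ↑ a)) (Equivalence.from (suc∈⇔∈ τ↑ a)) (cov a) })

shift-uncovers : (σ : Inc N R) (τ : Inc N S) → ¬ CoversPair (shift σ , shift τ)
shift-uncovers _ _ cov = [ zero∉sucs , zero∉sucs ] (cov zero)

suc-≡⇔ : {m n : ℕ} → (m ≡ n) ⇔ (suc m ≡ suc n)
suc-≡⇔ = mk⇔ (cong suc) suc-injective

decode-covers : (m : Mask N I) (sh : Shape I R S) → CoversPair (decode m sh) ⇔ (I ≡ N)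
decode-covers done done = mk⇔ (λ _ → refl) (λ _ ())
decode-covers (skip m) sh = let σ , τ = decode m sh in
  mk⇔ (⊥-elim ∘ shift-uncovers σ τ) (λ I≡1+N → ⊥-elim (1+n≰n (subst (_≤ℕ _) I≡1+N (Mask-bound m))))
decode-covers (keep m) (left sh) = let σ , τ = decode m sh in
  ⇔-trans (lift-covers (cons0-lifts σ) (shift-lifts τ) (inj₁ (here refl))) (⇔-trans (decode-covers m sh) suc-≡⇔)
decode-covers (keep m) (both sh) = let σ , τ = decode m sh in
  ⇔-trans (lift-covers (cons0-lifts σ) (cons0-lifts τ) (inj₁ (here refl))) (⇔-trans (decode-covers m sh) suc-≡⇔)
decode-covers (keep m) (right sh) = let σ , τ = decode m sh in
  ⇔-trans (lift-covers (shift-lifts σ) (cons0-lifts τ) (inj₂ (here refl))) (⇔-trans (decode-covers m sh) suc-≡⇔)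

Shapes : ℕ → ℕ → Set
Shapes N K = Σ[ R ∈ ℕ ] Σ[ S ∈ ℕ ] R + S ≡ K × Shape N R S

rights : ∀ N → Shape N 0 N
rights zero = done
rights (suc N) = right (rights N)

rights-unique : (sh : Shape N 0 S) → _≡_ {A = Σ ℕ (Shape N 0)} (S , sh) (N , rights N)
rights-unique done = refl
rights-unique (right sh) = cong (λ (S , sh) → suc S , right sh) (rights-unique sh)

Shapes-zero↔ : Shapes 0 K ↔ (0 ≡ K)
Shapes-zero↔ = mk↔ₛ′ (λ { (0 , 0 , e , done) → e }) (λ e → 0 , 0 , e , done)
  (λ _ → refl) (λ { (0 , 0 , _ , done) → refl })

Shapes-suc-zero : ¬ Shapes (suc N) 0
Shapes-suc-zero (_ , _ , () , left _)
Shapes-suc-zero (_ , _ , () , both _)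
Shapes-suc-zero (_ , _ , () , right _)

Shapes-suc↔ : Shapes (suc N) (suc K) ↔ (K ≡ N ⊎ K ≡ suc N ⊎ Shapes N K)
Shapes-suc↔ {N} {K} = mk↔ₛ′ to from to∘from from∘to
  where
  to : Shapes (suc N) (suc K) → K ≡ N ⊎ K ≡ suc N ⊎ Shapes N K
  to (_ , _ , e , right sh) = inj₁ (trans (sym (suc-injective e)) (cong proj₁ (rights-unique sh)))
  to (_ , _ , e , both sh) = inj₂ (inj₁ (trans (sym (suc-injective e)) (cong (suc ∘ proj₁) (rights-unique sh))))
  to (_ , S , e , left sh) = inj₂ (inj₂ (_ , S , suc-injective e , sh))
  from : K ≡ N ⊎ K ≡ suc N ⊎ Shapes N K → Shapes (suc N) (suc K)
  from (inj₁ K≡N) = 0 , suc N , cong suc (sym K≡N) , right (rights N)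
  from (inj₂ (inj₁ K≡1+N)) = 1 , suc N , cong suc (sym K≡1+N) , both (rights N)
  from (inj₂ (inj₂ (R , S , e , sh))) = suc R , S , cong suc e , left sh
  to∘from : ∀ y → to (from y) ≡ y
  to∘from (inj₁ _) = cong inj₁ (≡-irrelevant _ _)
  to∘from (inj₂ (inj₁ _)) = cong (inj₂ ∘ inj₁) (≡-irrelevant _ _)
  to∘from (inj₂ (inj₂ (R , S , _ , sh))) = cong (λ e → inj₂ (inj₂ (R , S , e , sh))) (≡-irrelevant _ _)
  canonical : ∀ {R S} {sh : Shape N 0 S} (c : ∀ {S} → Shape N 0 S → Shape (suc N) R (suc S)) →
    _≡_ {A = Σ ℕ (Shape N 0)} (S , sh) (N , rights N) →
    (e : R + suc N ≡ suc K) (e′ : R + suc S ≡ suc K) →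
    _≡_ {A = Shapes (suc N) (suc K)} (R , suc N , e , c (rights N)) (R , suc S , e′ , c sh)
  canonical {R} c refl e e′ = cong (λ e → R , suc N , e , c (rights N)) (≡-irrelevant e e′)
  from∘to : ∀ x → from (to x) ≡ x
  from∘to (_ , _ , e , right sh) = canonical right (rights-unique sh) _ e
  from∘to (_ , _ , e , both sh) = canonical both (rights-unique sh) _ e
  from∘to (R , S , _ , left sh) = cong (λ e → R , S , e , left sh) (≡-irrelevant _ _)

Shapes-diag↔ : ∀ N → Shapes N N ↔ Fin (suc N)
Shapes-diag↔ zero = ↔-trans Shapes-zero↔ (≡↔Fin1 refl)
Shapes-diag↔ (suc N) =
  ↔-trans Shapes-suc↔ (↔-trans (≡↔Fin1 refl ⊎-↔ ¬→↔Fin0 (1+n≢n ∘ sym) ⊎-↔ Shapes-diag↔ N) ⊎₃↔Fin+)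

Shapes-above-diag↔ : ∀ N → Shapes N (suc N) ↔ Fin N
Shapes-above-diag↔ zero = ↔-trans Shapes-zero↔ (¬→↔Fin0 λ ())
Shapes-above-diag↔ (suc N) =
  ↔-trans Shapes-suc↔ (↔-trans (¬→↔Fin0 1+n≢n ⊎-↔ ≡↔Fin1 refl ⊎-↔ Shapes-above-diag↔ N) ⊎₃↔Fin+)

Shapes-empty : K ≢ N → K ≢ suc N → ¬ Shapes N K
Shapes-empty {N = zero} K≢0 _ = K≢0 ∘ sym ∘ Inverse.to Shapes-zero↔
Shapes-empty {zero} {suc N} _ _ = Shapes-suc-zero
Shapes-empty {suc K} {suc N} K≢N K≢2+N =
  [ K≢N ∘ cong suc , [ K≢2+N ∘ cong suc , Shapes-empty (K≢N ∘ cong suc) (K≢2+N ∘ cong suc) ] ]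
  ∘ Inverse.to Shapes-suc↔

Cil-≡ : ∀ {P Q} {x : Inc N P × Inc N Q} {σ τ} .{e : P + Q ≡ K} .{p : proj₁ x ≼ proj₂ x} .{q : σ ≼ τ} →
  x ≡ (σ , τ) → mkCil P Q e (proj₁ x) (proj₂ x) p ≡ mkCil P Q e σ τ q
Cil-≡ refl = refl

Cil↔Σ-Mask×Shapes : Cil N K ↔ (Σ[ I ∈ ℕ ] Mask N I × Shapes I K)
Cil↔Σ-Mask×Shapes {N} {K} = mk↔ₛ′ to from to∘from from∘to
  where
  withSizes : R + S ≡ K → Factored N R S → Σ[ I ∈ ℕ ] Mask N I × Shapes I K
  withSizes {R} {S} e (I , m , sh) = I , m , R , S , e , sh
  to : Cil N K → Σ[ I ∈ ℕ ] Mask N I × Shapes I K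
  to (mkCil P Q e σ τ σ≼τ) = withSizes (recompute (P + Q ≟ K) e) (encode σ τ σ≼τ)
  from : Σ[ I ∈ ℕ ] Mask N I × Shapes I K → Cil N K
  from (I , m , R , S , e , sh) = mkCil R S e (proj₁ (decode m sh)) (proj₂ (decode m sh)) (decode-≼ m sh)
  to∘from : ∀ y → to (from y) ≡ y
  to∘from (I , m , R , S , e , sh) = cong₂ withSizes (≡-irrelevant _ e) (encode-decode m sh)
  from∘to : ∀ x → from (to x) ≡ x
  from∘to (mkCil P Q e σ τ σ≼τ) = Cil-≡ (decode-encode σ τ σ≼τ)

BreveCil↔Shapes : BreveCil N K ↔ Shapes N K
BreveCil↔Shapes = ↔-trans (Sub-↔ Cil↔Σ-Mask×Shapes λ (_ , m , _ , _ , _ , sh) → decode-covers m sh)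
  (↔-trans Sub-Σ-≡↔ Mask-full×↔)

CilBoundary↔Σ< : CilBoundary N K ↔ Σ< N (λ I → Mask N I × Shapes I K)
CilBoundary↔Σ< = ↔-trans (Sub-↔ Cil↔Σ-Mask×Shapes λ (_ , m , _ , _ , _ , sh) → ¬-cong-⇔ (decode-covers m sh))
  (Sub-Σ-≢↔ (Mask-bound ∘ proj₁))

covers? : (c : Cil N K) → Dec (Covers c)
covers? c = all? λ a → DecMembership._∈?_ _≟ᶠ_ a (vals (σ c)) ⊎-dec DecMembership._∈?_ _≟ᶠ_ a (vals (τ c))

mainTheorem4 : (N : ℕ) →
    ((BreveCil N N ↔ Fin (suc N))
    × (BreveCil N (suc N) ↔ Fin N)
    × (∀ (K : ℕ) → K ≢ N → K ≢ suc N → BreveCil N K ↔ Fin 0))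
    × (∀ (b : ℕ → ℕ → ℕ) → (∀ (I K : ℕ) → BreveCil I K ↔ Fin (b I K)) →
    ∀ (K : ℕ) → CilBoundary N K ↔ Fin (sum (map (λ I → (N C I) * b I K) (upTo N))))
    × (∀ (K c b : ℕ) → CilBoundary N K ↔ Fin c → BreveCil N K ↔ Fin b →
    Cil N K ↔ Fin (c + b))
mainTheorem4 N =
  ( ↔-trans BreveCil↔Shapes (Shapes-diag↔ N)
  , ↔-trans BreveCil↔Shapes (Shapes-above-diag↔ N)
  , λ K K≢N K≢1+N → ↔-trans BreveCil↔Shapes (¬→↔Fin0 (Shapes-empty K≢N K≢1+N)) )
  , (λ b breve↔b K → ↔-trans CilBoundary↔Σ< (Σ<↔Fin-sum _ λ I →
       ↔-trans (Mask↔Fin-C N I ×-↔ ↔-trans (↔-sym BreveCil↔Shapes) (breve↔b I K)) (↔-sym *↔×)))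
  , λ K c b ∂↔c breve↔b → ↔-trans (↔-Sub-¬⊎Sub covers?) (↔-trans (∂↔c ⊎-↔ breve↔b) (↔-sym +↔⊎))
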